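{- Let $n$ be a non-negative integer and let $m=\lfloor\frac n3\rfloor+\delta_{1,(n\bmod 3)}$. For every $k\in\{0,\dots,m-1\}$ let $\nabla_k\in\mathcal{RST}(n)$ be such that $H^k(\nabla_k)=U_{n-3k}$. Then $\{\nabla_0,\dots,\nabla_{m-1}\}$ is a basis of $\mathcal{RST}(n)$.
   Context: A binary Steinhaus triangle of size $n\ge0$ is an array $(a_{i,j})_{1\le i\le j\le n}$ of elements of $\{0,1\}$ with $a_{i,j}\equiv a_{i-1,j-1}+a_{i-1,j}\pmod 2$ for all $2\le i\le j\le n$. $\nabla S$ denotes the triangle with first row $S$. These triangles form a vector space $\mathcal{ST}(n)$ over $\mathbb{Z}/2\mathbb{Z}$. The rotation is $r((a_{i,j}))=(a_{j-i+1,n-i+1})_{1\le i\le j\le n}$, and $\mathcal{RST}(n)=\{\nabla: r(\nabla)=\nabla\}$. Let $\rho=r^2+r+\mathrm{id}$, and let $U_N=\rho(\nabla(1)_N)$, where $(1)_N$ is the all-ones sequence of length $N$. Equivalently, $U_N=(\delta_{i,1}+\delta_{i,j}+\delta_{j,N}\bmod 2)_{1\le i\le j\le N}$. For $3k\le n$, $H^k:\mathcal{ST}(n)\to\mathcal{ST}(n-3k)$ is $(a_{i,j})\mapsto(a_{k+i,2k+j})_{1\le i\le j\le n-3k}$. The symbol $\delta_{a,(n\bmod b)}$ equals $1$ if $n\equiv a\pmod b$ and $0$ otherwise. -}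

module Defs where

open import Data.Bool using (Bool; true; false; _xor_; if_then_else_)
open import Data.Nat using (ℕ; zero; suc; _+_; _*_; _∸_; _≤_; _<_; pred; _/_; _%_; _≡ᵇ_)
open import Data.Product using (Σ; _×_)
open import Relation.Binary.PropositionalEquality using (_≡_)

-- A (candidate) triangle: an array of bits indexed 1-based by (i , j);
-- only the entries with 1 ≤ i ≤ j ≤ n are meaningful for size n.
Arr : Set
Arr = ℕ → ℕ → Bool

_≈[_]_ : Arr → ℕ → Arr → Set
a ≈[ n ] b = ∀ i j → 1 ≤ i → i ≤ j → j ≤ n → a i j ≡ b i j

IsST : ℕ → Arr → Set
IsST n a = ∀ i j → 2 ≤ i → i ≤ j → j ≤ n →
  a i j ≡ (a (i ∸ 1) (j ∸ 1) xor a (i ∸ 1) j)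

zeroA : Arr
zeroA _ _ = false

_⊕_ : Arr → Arr → Arr
(a ⊕ b) i j = a i j xor b i j

rot : ℕ → Arr → Arr
rot n a i j = a (j ∸ i + 1) (n ∸ i + 1)

IsRST : ℕ → Arr → Set
IsRST n a = IsST n a × (rot n a ≈[ n ] a)

-- ∇S : triangle with first row S (S given as a function of the column index j)
nabla : (ℕ → Bool) → Arr
nabla s zero j = false
nabla s (suc zero) j = s j
nabla s (suc (suc i)) j = nabla s (suc i) (pred j) xor nabla s (suc i) j

ρ : ℕ → Arr → Arr
ρ n a = (rot n (rot n a) ⊕ rot n a) ⊕ a

U : ℕ → Arr
U N = ρ N (nabla (λ _ → true))

H : ℕ → Arr → Arr
H k a i j = a (k + i) (2 * k + j)

δ1mod3 : ℕ → ℕ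
δ1mod3 n = if (n % 3) ≡ᵇ 1 then 1 else 0

lin : ℕ → (ℕ → Bool) → (ℕ → Arr) → Arr
lin zero c v = zeroA
lin (suc m) c v = lin m c v ⊕ (if c m then v m else zeroA)

IsBasisRST : ℕ → ℕ → (ℕ → Arr) → Set
IsBasisRST n m v =
  (∀ k → k < m → IsRST n (v k))
  × ((c : ℕ → Bool) → lin m c v ≈[ n ] zeroA → ∀ k → k < m → c k ≡ false)
  × ((a : Arr) → IsRST n a → Σ (ℕ → Bool) λ c → a ≈[ n ] lin m c v)

module Submission where

-- H^k strips k outer layers off a triangle, and maps RST(n) into RST(n - 3k).
-- The central fact is a peeling lemma: if b ∈ RST(N) and H¹(b) = 0 (only the
-- outer layer of b may be non-zero), then b = 0 or b = U_N; the Steinhaus rule on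
-- row 2 makes row 1 constant, and the rotation copies row 1 to the other two sides.
-- Together with the closed form U_N[i,j] = [j = N] + [i = j] + [i = 1] this gives:
--   * independence: H^M(T_j) = 0 for j < M, so on layer M a combination of
--     T_0, …, T_M equals c_M · U_{n-3M}, which is non-zero exactly when M < m(n);
--   * spanning: by induction on the number k of layers on which a ∈ RST(n) lives,
--     its innermost layer H^{k-1}(a) is 0 or U_{n-3(k-1)}, and in the second case
--     a + T_{k-1} lives on fewer layers.

open import Defs
open import Data.Bool using (Bool; true; false; not; _xor_; _∧_; if_then_else_)
open import Data.Bool.Properties
  using ( xor-same; xor-identityʳ; xor-assoc; xor-comm; ∧-zeroʳ; ∧-identityʳ
        ; not-distribˡ-xor; not-distribʳ-xor; xor-annihilates-not )
open import Data.Nat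
open import Data.Nat.Properties
open import Data.Nat.DivMod using (m/n≡1+[m∸n]/n; [m+n]%n≡m%n)
open import Data.Nat.Tactic.RingSolver using (solve-∀)
open import Data.Product using (Σ; _×_; _,_; proj₁; proj₂)
open import Data.Sum using (_⊎_; inj₁; inj₂)
open import Relation.Nullary using (Dec; ¬_; does; yes; no; contradiction)
open import Relation.Nullary.Decidable using (dec-true; dec-false)
open import Relation.Binary.PropositionalEquality

xor-cancelʳ : ∀ a b → (a xor b) xor b ≡ a
xor-cancelʳ false false = refl
xor-cancelʳ false true  = refl
xor-cancelʳ true  false = refl
xor-cancelʳ true  true  = refl

xor≡false : ∀ a c → a xor c ≡ false → a ≡ c
xor≡false false false _ = refl
xor≡false true  true  _ = refl

xor≡right : ∀ a c → a xor c ≡ c → a ≡ false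
xor≡right false c _ = refl
xor≡right true false ()
xor≡right true true  ()

xor-interchange : ∀ p q r s → (p xor q) xor (r xor s) ≡ (p xor r) xor (q xor s)
xor-interchange false false r s = refl
xor-interchange false true  r s = not-distribʳ-xor r s
xor-interchange true  false r s = not-distribˡ-xor r s
xor-interchange true  true  r s = sym (xor-annihilates-not r s)

xor-swapʳ : ∀ a b c → (a xor b) xor c ≡ (a xor c) xor b
xor-swapʳ a b c = trans (xor-assoc a b c) (trans (cong (a xor_) (xor-comm b c)) (sym (xor-assoc a c b)))

xor-toggle : ∀ l t w → l xor (not t ∧ w) ≡ (l xor (t ∧ w)) xor w
xor-toggle l false w = cong (_xor w) (sym (xor-identityʳ l))
xor-toggle l true  w = trans (xor-identityʳ l) (sym (xor-cancelʳ l w))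

nabla-ones : ∀ x y → nabla (λ _ → true) x y ≡ (x ≡ᵇ 1)
nabla-ones zero          y = refl
nabla-ones (suc zero)    y = refl
nabla-ones (suc (suc x)) y =
  trans (cong₂ _xor_ (nabla-ones (suc x) (pred y)) (nabla-ones (suc x) y)) (xor-same (x ≡ᵇ 0))

+1≡ᵇ1 : ∀ x → (x + 1 ≡ᵇ 1) ≡ (x ≡ᵇ 0)
+1≡ᵇ1 x = cong (_≡ᵇ 1) (+-comm x 1)

∸≡ᵇ0 : ∀ {m n} → m ≤ n → (n ∸ m ≡ᵇ 0) ≡ (m ≡ᵇ n)
∸≡ᵇ0 {n = zero}  z≤n = refl
∸≡ᵇ0 {n = suc n} z≤n = refl
∸≡ᵇ0 (s≤s m≤n) = ∸≡ᵇ0 m≤n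

rot²-row : ∀ {N i j} → i ≤ j → j ≤ N → (N ∸ i + 1) ∸ (j ∸ i + 1) ≡ N ∸ j
rot²-row {N} {i} {j} i≤j j≤N = begin
  (N ∸ i + 1) ∸ (j ∸ i + 1)  ≡⟨ cong₂ _∸_ (+-comm (N ∸ i) 1) (+-comm (j ∸ i) 1) ⟩
  (N ∸ i) ∸ (j ∸ i)          ≡⟨ ∸-+-assoc N i (j ∸ i) ⟩
  N ∸ (i + (j ∸ i))          ≡⟨ cong (N ∸_) (m+[n∸m]≡n i≤j) ⟩
  N ∸ j                      ∎
  where open ≡-Reasoning

-- Closed form: U_N[i,j] = [j = N] + [i = j] + [i = 1], one term per side of the triangle.
U-closed : ∀ N i j → i ≤ j → j ≤ N → U N i j ≡ (does (j ≟ N) xor does (i ≟ j)) xor does (i ≟ 1)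
U-closed N i j i≤j j≤N = cong₂ _xor_ (cong₂ _xor_ lastColumn diagonal) (nabla-ones i j)
  where
  lastColumn : nabla (λ _ → true) ((N ∸ i + 1) ∸ (j ∸ i + 1) + 1) (N ∸ (j ∸ i + 1) + 1) ≡ (j ≡ᵇ N)
  lastColumn = begin
    nabla (λ _ → true) ((N ∸ i + 1) ∸ (j ∸ i + 1) + 1) (N ∸ (j ∸ i + 1) + 1)
                                         ≡⟨ nabla-ones ((N ∸ i + 1) ∸ (j ∸ i + 1) + 1) (N ∸ (j ∸ i + 1) + 1) ⟩
    ((N ∸ i + 1) ∸ (j ∸ i + 1) + 1 ≡ᵇ 1) ≡⟨ +1≡ᵇ1 ((N ∸ i + 1) ∸ (j ∸ i + 1)) ⟩
    ((N ∸ i + 1) ∸ (j ∸ i + 1) ≡ᵇ 0)     ≡⟨ cong (_≡ᵇ 0) (rot²-row i≤j j≤N) ⟩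
    (N ∸ j ≡ᵇ 0)                         ≡⟨ ∸≡ᵇ0 j≤N ⟩
    (j ≡ᵇ N)                             ∎
    where open ≡-Reasoning
  diagonal : nabla (λ _ → true) (j ∸ i + 1) (N ∸ i + 1) ≡ (i ≡ᵇ j)
  diagonal = trans (nabla-ones (j ∸ i + 1) (N ∸ i + 1)) (trans (+1≡ᵇ1 (j ∸ i)) (∸≡ᵇ0 i≤j))

U-interior : ∀ {N i j} → 2 ≤ i → i < j → j < N → U N i j ≡ false
U-interior {N} {i} {j} 2≤i i<j j<N = begin
  U N i j                                          ≡⟨ U-closed N i j (<⇒≤ i<j) (<⇒≤ j<N) ⟩
  (does (j ≟ N) xor does (i ≟ j)) xor does (i ≟ 1)
    ≡⟨ cong₂ (λ p q → (p xor q) xor does (i ≟ 1)) (dec-false (j ≟ N) (<⇒≢ j<N)) (dec-false (i ≟ j) (<⇒≢ i<j)) ⟩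
  does (i ≟ 1)                                     ≡⟨ dec-false (i ≟ 1) (>⇒≢ 2≤i) ⟩
  false                                            ∎
  where open ≡-Reasoning

-- The sizes N for which U_N is non-zero: U_0 is empty and U_2 vanishes identically.
UNonzero : ℕ → Set
UNonzero N = N ≡ 1 ⊎ 3 ≤ N

U-witness : ∀ {N} → UNonzero N → Σ ℕ λ i → Σ ℕ λ j → 1 ≤ i × i ≤ j × j ≤ N × U N i j ≡ true
U-witness (inj₁ refl) = 1 , 1 , ≤-refl , ≤-refl , ≤-refl , refl
U-witness {N} (inj₂ 3≤N) = 1 , 2 , ≤-refl , n≤1+n 1 , ≤-trans (n≤1+n 2) 3≤N ,
  trans (U-closed N 1 2 (n≤1+n 1) (≤-trans (n≤1+n 2) 3≤N)) (cong (λ p → (p xor false) xor true) (dec-false (2 ≟ N) (<⇒≢ 3≤N)))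

fits : ∀ {x l N} → 1 ≤ l → l ≤ N ∸ x → x + l ≤ N
fits {x} {l} {N} 1≤l l≤N∸x = subst (_≤ N) (+-comm l x) (m≤o∸n⇒m+n≤o l x≤N l≤N∸x)
  where
  x≤N : x ≤ N
  x≤N = <⇒≤ (m∸n≢0⇒n<m (≢-sym (<⇒≢ (≤-trans 1≤l l≤N∸x))))

≈-empty : ∀ {a c} → a ≈[ 0 ] c
≈-empty (suc i) j (s≤s z≤n) (s≤s i≤j) ()

RST-⊕ : ∀ {N a c} → IsRST N a → IsRST N c → IsRST N (a ⊕ c)
RST-⊕ {N} {a} {c} (a-st , a-rot) (c-st , c-rot) = st , rt
  where
  st : IsST N (a ⊕ c)
  st i j 2≤i i≤j j≤N =
    trans (cong₂ _xor_ (a-st i j 2≤i i≤j j≤N) (c-st i j 2≤i i≤j j≤N))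
          (xor-interchange (a (i ∸ 1) (j ∸ 1)) (a (i ∸ 1) j) (c (i ∸ 1) (j ∸ 1)) (c (i ∸ 1) j))
  rt : rot N (a ⊕ c) ≈[ N ] (a ⊕ c)
  rt i j 1≤i i≤j j≤N = cong₂ _xor_ (a-rot i j 1≤i i≤j j≤N) (c-rot i j 1≤i i≤j j≤N)

RST-cong : ∀ {N a c} → (∀ i j → a i j ≡ c i j) → IsRST N a → IsRST N c
RST-cong {a = a} {c} a≡c (a-st , a-rot) =
  (λ i j 2≤i i≤j j≤N → trans (sym (a≡c i j))
     (trans (a-st i j 2≤i i≤j j≤N) (cong₂ _xor_ (a≡c (i ∸ 1) (j ∸ 1)) (a≡c (i ∸ 1) j)))) ,
  (λ i j 1≤i i≤j j≤N → trans (sym (a≡c _ _)) (trans (a-rot i j 1≤i i≤j j≤N) (a≡c i j)))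

rot-column-shift : ∀ N i → 3 + i ≤ N → 2 + ((N ∸ 3) ∸ i + 1) ≡ N ∸ suc i + 1
rot-column-shift (suc (suc (suc N))) i (s≤s (s≤s (s≤s i≤N))) = cong (_+ 1) (sym (+-∸-assoc 2 i≤N))

H1-RST : ∀ {N a} → IsRST N a → IsRST (N ∸ 3) (H 1 a)
H1-RST {N} {a} (a-st , a-rot) = st , rt
  where
  st : IsST (N ∸ 3) (H 1 a)
  st (suc (suc i)) (suc j) (s≤s (s≤s z≤n)) i≤j j≤N∸3 =
    a-st (3 + i) (3 + j) (s≤s (s≤s z≤n)) (s≤s (≤-trans i≤j (n≤1+n (suc j))))
         (≤-trans (n≤1+n (3 + j)) (fits {3} (s≤s z≤n) j≤N∸3))
  rt : rot (N ∸ 3) (H 1 a) ≈[ N ∸ 3 ] H 1 a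
  rt i j 1≤i i≤j j≤N∸3 =
    trans (cong₂ a (cong (_+ 1) (sym (+-∸-assoc 1 i≤j))) (rot-column-shift N i (≤-trans (+-monoʳ-≤ 3 i≤j) 3+j≤N)))
          (a-rot (1 + i) (2 + j) (s≤s z≤n) (s≤s (≤-trans i≤j (n≤1+n j))) (≤-trans (n≤1+n (2 + j)) 3+j≤N))
    where
    3+j≤N : 3 + j ≤ N
    3+j≤N = fits (≤-trans 1≤i i≤j) j≤N∸3

H-compose : ∀ d k a i j → H (d + k) a i j ≡ H d (H k a) i j
H-compose d k a i j = cong₂ a (row d k i) (column d k j)
  where
  row : ∀ d k i → d + k + i ≡ k + (d + i)
  row = solve-∀
  column : ∀ d k j → 2 * (d + k) + j ≡ 2 * k + (2 * d + j)
  column = solve-∀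

H-size : ∀ N d k → N ∸ 3 * (d + k) ≡ (N ∸ 3 * k) ∸ 3 * d
H-size N d k = begin
  N ∸ 3 * (d + k)        ≡⟨ cong (N ∸_) (trans (*-distribˡ-+ 3 d k) (+-comm (3 * d) (3 * k))) ⟩
  N ∸ (3 * k + 3 * d)    ≡⟨ ∸-+-assoc N (3 * k) (3 * d) ⟨
  (N ∸ 3 * k) ∸ 3 * d    ∎
  where open ≡-Reasoning

Hk-RST : ∀ {N} k a → IsRST N a → IsRST (N ∸ 3 * k) (H k a)
Hk-RST zero    a a-rst = a-rst
Hk-RST {N} (suc k) a a-rst =
  subst (λ M → IsRST M (H (suc k) a)) (sym (H-size N 1 k))
        (RST-cong (λ i j → sym (H-compose 1 k a i j)) (H1-RST (Hk-RST k a a-rst)))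

H-respects : ∀ {N a c} d → a ≈[ N ] c → H d a ≈[ N ∸ 3 * d ] H d c
H-respects {N} d a≈c i l 1≤i i≤l l≤ =
  a≈c (d + i) (2 * d + l) (≤-trans 1≤i (m≤n+m i d)) (+-mono-≤ (m≤m+n d (d + 0)) i≤l)
      (≤-trans (+-monoˡ-≤ l (m≤n+m (2 * d) d)) (fits (≤-trans 1≤i i≤l) l≤))

H-top-layer : ∀ N k a → H (suc k) a ≈[ N ∸ 3 * suc k ] zeroA → H 1 (H k a) ≈[ (N ∸ 3 * k) ∸ 3 ] zeroA
H-top-layer N k a top≈0 i j 1≤i i≤j j≤ =
  trans (sym (H-compose 1 k a i j)) (top≈0 i j 1≤i i≤j (subst (j ≤_) (sym (H-size N 1 k)) j≤))

-- For d ≥ 1, H^d only sees the interior of U_N, hence H^d(U_N) = 0.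
H-U-vanishes : ∀ N d → 1 ≤ d → H d (U N) ≈[ N ∸ 3 * d ] zeroA
H-U-vanishes N d 1≤d i l 1≤i i≤l l≤ = U-interior (+-mono-≤ 1≤d 1≤i) row<column column<N
  where
  open ≤-Reasoning
  row<column : d + i < 2 * d + l
  row<column = begin-strict
    d + i        ≤⟨ +-monoʳ-≤ d i≤l ⟩
    d + l        <⟨ +-monoˡ-< l (m<m+n d (+-monoˡ-≤ 0 1≤d)) ⟩
    2 * d + l    ∎
  column<N : 2 * d + l < N
  column<N = begin-strict
    2 * d + l    <⟨ +-monoˡ-< l (m<n+m (2 * d) 1≤d) ⟩
    3 * d + l    ≤⟨ fits (≤-trans 1≤i i≤l) l≤ ⟩
    N            ∎

mirror-bounds : ∀ {N i} → 2 ≤ i → i < N → 2 ≤ N ∸ i + 1 × N ∸ i + 1 < N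
mirror-bounds {N} {i} 2≤i i<N = lower , upper
  where
  open ≤-Reasoning
  lower : 2 ≤ N ∸ i + 1
  lower = +-monoˡ-≤ 1 (m<n⇒0<n∸m i<N)
  upper : N ∸ i + 1 < N
  upper = begin-strict
    N ∸ i + 1   <⟨ +-monoʳ-< (N ∸ i) ≤-refl ⟩
    N ∸ i + 2   ≤⟨ +-monoʳ-≤ (N ∸ i) 2≤i ⟩
    N ∸ i + i   ≡⟨ m∸n+n≡m (<⇒≤ i<N) ⟩
    N           ∎

-- The Steinhaus rule on row 2 makes row 1 constant on its interior, the rotation
-- transports row 1 to the diagonal and the last column, and the corners are forced to 0.
module Peel (N : ℕ) (3≤N : 3 ≤ N) (b : Arr) (b-rst : IsRST N b) (b-top : H 1 b ≈[ N ∸ 3 ] zeroA) where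

  y : Bool
  y = b 1 2

  b-st : IsST N b
  b-st = proj₁ b-rst

  b-rot : rot N b ≈[ N ] b
  b-rot = proj₂ b-rst

  -- strictly inside the triangle, b is an entry of H¹(b) = 0
  interior : ∀ {i j} → 2 ≤ i → i < j → j < N → b i j ≡ false
  interior {suc i} {suc (suc j)} (s≤s 1≤i) (s≤s (s≤s i≤j)) j<N = b-top i j 1≤i i≤j (∸-monoˡ-≤ 3 j<N)

  -- row 2 vanishes in its interior, so consecutive interior entries of row 1 agree
  rowOne : ∀ j → 2 ≤ j → j < N → b 1 j ≡ y
  rowOne (suc zero)          (s≤s ()) _
  rowOne (suc (suc zero))    _ _   = refl
  rowOne (suc (suc (suc j))) _ j<N =
    trans (sym (xor≡false _ _ row2)) (rowOne (suc (suc j)) (s≤s (s≤s z≤n)) (<⇒≤ j<N))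
    where
    row2 : b 1 (2 + j) xor b 1 (3 + j) ≡ false
    row2 = trans (sym (b-st 2 (3 + j) ≤-refl (s≤s (s≤s z≤n)) (<⇒≤ j<N)))
                 (interior ≤-refl (s≤s (s≤s (s≤s z≤n))) j<N)

  diagonal-to-rowOne : ∀ i → 1 ≤ i → i ≤ N → b i i ≡ b 1 (N ∸ i + 1)
  diagonal-to-rowOne i 1≤i i≤N =
    trans (sym (b-rot i i 1≤i ≤-refl i≤N)) (cong (λ x → b (x + 1) (N ∸ i + 1)) (n∸n≡0 i))

  diagonal : ∀ i → 2 ≤ i → i < N → b i i ≡ y
  diagonal i 2≤i i<N =
    trans (diagonal-to-rowOne i (<⇒≤ 2≤i) (<⇒≤ i<N))
          (rowOne (N ∸ i + 1) (proj₁ (mirror-bounds 2≤i i<N)) (proj₂ (mirror-bounds 2≤i i<N)))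

  -- the rotation maps the last-column entry (i , N) to the diagonal entry (N - i + 1 , N - i + 1)
  lastColumn : ∀ i → 2 ≤ i → i < N → b i N ≡ y
  lastColumn i 2≤i i<N =
    trans (sym (b-rot i N (<⇒≤ 2≤i) (<⇒≤ i<N) ≤-refl))
          (diagonal (N ∸ i + 1) (proj₁ (mirror-bounds 2≤i i<N)) (proj₂ (mirror-bounds 2≤i i<N)))

  -- the corners: b₂₂ = b₁₁ + b₁₂ with b₂₂ = y, and the rotation permutes the three corners
  corner₁₁ : b 1 1 ≡ false
  corner₁₁ = xor≡right (b 1 1) y (trans (sym (b-st 2 2 ≤-refl ≤-refl 2≤N)) (diagonal 2 ≤-refl 3≤N))
    where
    2≤N : 2 ≤ N
    2≤N = ≤-trans (n≤1+n 2) 3≤N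

  corner₁N : b 1 N ≡ false
  corner₁N = trans (cong (b 1) (sym (m∸n+n≡m 1≤N))) (trans (b-rot 1 1 ≤-refl ≤-refl 1≤N) corner₁₁)
    where
    1≤N : 1 ≤ N
    1≤N = ≤-trans (s≤s z≤n) 3≤N

  cornerNN : b N N ≡ false
  cornerNN = trans (diagonal-to-rowOne N (≤-trans (s≤s z≤n) 3≤N) ≤-refl)
                   (trans (cong (λ x → b 1 (x + 1)) (n∸n≡0 N)) corner₁₁)

  -- Every entry equals y·U_N, by the closed form of U_N; the cases are the seven
  -- regions of the triangle cut out by the conditions j = N, i = j, i = 1.
  entry : ∀ i j → 1 ≤ i → i ≤ j → j ≤ N → b i j ≡ y ∧ U N i j
  entry i j 1≤i i≤j j≤N =
    trans (regions i j 1≤i i≤j j≤N (j ≟ N) (i ≟ j) (i ≟ 1)) (cong (y ∧_) (sym (U-closed N i j i≤j j≤N)))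
    where
    regions : ∀ i j → 1 ≤ i → i ≤ j → j ≤ N → (j=N : Dec (j ≡ N)) (i=j : Dec (i ≡ j)) (i=1 : Dec (i ≡ 1)) →
              b i j ≡ y ∧ ((does j=N xor does i=j) xor does i=1)
    regions i j 1≤i i≤j j≤N (yes refl) (yes refl) (yes N≡1) = contradiction N≡1 (>⇒≢ (≤-trans (s≤s (s≤s z≤n)) 3≤N))
    regions i j 1≤i i≤j j≤N (yes refl) (yes refl) (no  _)   = trans cornerNN (sym (∧-zeroʳ y))
    regions i j 1≤i i≤j j≤N (yes refl) (no  _)    (yes refl) = trans corner₁N (sym (∧-zeroʳ y))
    regions i j 1≤i i≤j j≤N (yes refl) (no  i≢N)  (no  i≢1) =
      trans (lastColumn i (≤∧≢⇒< 1≤i (≢-sym i≢1)) (≤∧≢⇒< i≤j i≢N)) (sym (∧-identityʳ y))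
    regions i j 1≤i i≤j j≤N (no  _)    (yes refl) (yes refl) = trans corner₁₁ (sym (∧-zeroʳ y))
    regions i j 1≤i i≤j j≤N (no  j≢N)  (yes refl) (no  i≢1) =
      trans (diagonal i (≤∧≢⇒< 1≤i (≢-sym i≢1)) (≤∧≢⇒< j≤N j≢N)) (sym (∧-identityʳ y))
    regions i j 1≤i i≤j j≤N (no  j≢N)  (no  i≢j)  (yes refl) =
      trans (rowOne j (≤∧≢⇒< i≤j i≢j) (≤∧≢⇒< j≤N j≢N)) (sym (∧-identityʳ y))
    regions i j 1≤i i≤j j≤N (no  j≢N)  (no  i≢j)  (no  i≢1) =
      trans (interior (≤∧≢⇒< 1≤i (≢-sym i≢1)) (≤∧≢⇒< i≤j i≢j) (≤∧≢⇒< j≤N j≢N)) (sym (∧-zeroʳ y))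

  peel : (b ≈[ N ] zeroA) ⊎ (b ≈[ N ] U N)
  peel with y in y≡
  ... | false = inj₁ λ i j 1≤i i≤j j≤N → trans (entry i j 1≤i i≤j j≤N) (cong (_∧ U N i j) y≡)
  ... | true  = inj₂ λ i j 1≤i i≤j j≤N → trans (entry i j 1≤i i≤j j≤N) (cong (_∧ U N i j) y≡)

≈-size1 : ∀ {a c} → a 1 1 ≡ c 1 1 → a ≈[ 1 ] c
≈-size1 a₁₁≡c₁₁ (suc zero)    (suc zero)    _ _           _        = a₁₁≡c₁₁
≈-size1 a₁₁≡c₁₁ (suc (suc i)) (suc zero)    _ (s≤s ())    _
≈-size1 a₁₁≡c₁₁ i             (suc (suc j)) _ _           (s≤s ())

-- RST(2) = 0: the rotation identifies the three entries, and b₂₂ = b₁₁ + b₁₂.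
RST₂-zero : ∀ {b} → IsRST 2 b → b ≈[ 2 ] zeroA
RST₂-zero {b} (b-st , b-rot) = entries
  where
  b₁₂≡b₁₁ : b 1 2 ≡ b 1 1
  b₁₂≡b₁₁ = b-rot 1 1 ≤-refl ≤-refl (s≤s z≤n)
  b₂₂≡b₁₂ : b 2 2 ≡ b 1 2
  b₂₂≡b₁₂ = b-rot 1 2 ≤-refl (s≤s z≤n) ≤-refl
  b₁₁≡false : b 1 1 ≡ false
  b₁₁≡false = begin
    b 1 1             ≡⟨ trans b₂₂≡b₁₂ b₁₂≡b₁₁ ⟨
    b 2 2             ≡⟨ b-st 2 2 ≤-refl ≤-refl ≤-refl ⟩
    b 1 1 xor b 1 2   ≡⟨ cong (b 1 1 xor_) b₁₂≡b₁₁ ⟩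
    b 1 1 xor b 1 1   ≡⟨ xor-same (b 1 1) ⟩
    false             ∎
    where open ≡-Reasoning
  entries : b ≈[ 2 ] zeroA
  entries (suc zero)          (suc zero)          _ _ _ = b₁₁≡false
  entries (suc zero)          (suc (suc zero))    _ _ _ = trans b₁₂≡b₁₁ b₁₁≡false
  entries (suc (suc zero))    (suc (suc zero))    _ _ _ = trans b₂₂≡b₁₂ (trans b₁₂≡b₁₁ b₁₁≡false)
  entries (suc (suc i))       (suc zero)          _ (s≤s ())       _
  entries (suc (suc (suc i))) (suc (suc zero))    _ (s≤s (s≤s ())) _
  entries i                   (suc (suc (suc j))) _ _              (s≤s (s≤s ()))

peel-layer : ∀ N b → IsRST N b → H 1 b ≈[ N ∸ 3 ] zeroA → (b ≈[ N ] zeroA) ⊎ (b ≈[ N ] U N × UNonzero N)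
peel-layer zero b _ _ = inj₁ ≈-empty
peel-layer (suc zero) b _ _ with b 1 1 in b₁₁
... | false = inj₁ (≈-size1 b₁₁)
... | true  = inj₂ (≈-size1 b₁₁ , inj₁ refl)
peel-layer (suc (suc zero)) b b-rst _ = inj₁ (RST₂-zero b-rst)
peel-layer N@(suc (suc (suc _))) b b-rst b-top with Peel.peel N (s≤s (s≤s (s≤s z≤n))) b b-rst b-top
... | inj₁ b≈0 = inj₁ b≈0
... | inj₂ b≈U = inj₂ (b≈U , inj₂ (s≤s (s≤s (s≤s z≤n))))

dim : ℕ → ℕ
dim n = n / 3 + δ1mod3 n

dim-step : ∀ n → dim (3 + n) ≡ suc (dim n)
dim-step n = cong₂ _+_ (m/n≡1+[m∸n]/n {3 + n} {3} (m≤m+n 3 n)) (cong (λ r → if r ≡ᵇ 1 then 1 else 0) mod-step)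
  where
  mod-step : (3 + n) % 3 ≡ n % 3
  mod-step = trans (cong (_% 3) (+-comm 3 n)) ([m+n]%n≡m%n n 3)

size-step : ∀ n k → (3 + n) ∸ 3 * suc k ≡ n ∸ 3 * k
size-step n k = trans (cong (3 + n ∸_) (*-suc 3 k)) ([m+n]∸[m+o]≡n∸o 3 n (3 * k))

size-small : ∀ {n} k → n ≤ 2 → n ∸ 3 * suc k ≡ 0
size-small k n≤2 = m≤n⇒m∸n≡0 (≤-trans n≤2 (≤-trans (n≤1+n 2) (subst (3 ≤_) (sym (*-suc 3 k)) (m≤m+n 3 (3 * k)))))

UNonzero-0 : ¬ UNonzero 0
UNonzero-0 (inj₁ ())
UNonzero-0 (inj₂ ())

UNonzero-2 : ¬ UNonzero 2
UNonzero-2 (inj₁ ())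
UNonzero-2 (inj₂ (s≤s (s≤s ())))

below-dim⇒UNonzero : ∀ n k → k < dim n → UNonzero (n ∸ 3 * k)
below-dim⇒UNonzero (suc zero) zero _ = inj₁ refl
below-dim⇒UNonzero (suc zero) (suc k) (s≤s ())
below-dim⇒UNonzero (suc (suc (suc n))) zero _ = inj₂ (s≤s (s≤s (s≤s z≤n)))
below-dim⇒UNonzero (suc (suc (suc n))) (suc k) k<dim =
  subst UNonzero (sym (size-step n k)) (below-dim⇒UNonzero n k (≤-pred (subst (suc k <_) (dim-step n) k<dim)))

UNonzero⇒below-dim : ∀ n k → UNonzero (n ∸ 3 * k) → k < dim n
UNonzero⇒below-dim zero k nz = contradiction (subst UNonzero (0∸n≡0 (3 * k)) nz) UNonzero-0
UNonzero⇒below-dim (suc zero) zero _ = s≤s z≤n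
UNonzero⇒below-dim (suc zero) (suc k) nz = contradiction (subst UNonzero (size-small k (n≤1+n 1)) nz) UNonzero-0
UNonzero⇒below-dim (suc (suc zero)) zero nz = contradiction nz UNonzero-2
UNonzero⇒below-dim (suc (suc zero)) (suc k) nz = contradiction (subst UNonzero (size-small k ≤-refl) nz) UNonzero-0
UNonzero⇒below-dim (suc (suc (suc n))) zero _ = subst (0 <_) (sym (dim-step n)) (s≤s z≤n)
UNonzero⇒below-dim (suc (suc (suc n))) (suc k) nz =
  subst (suc k <_) (sym (dim-step n)) (s≤s (UNonzero⇒below-dim n k (subst UNonzero (size-step n k) nz)))

summand : ∀ t (v : Arr) x y → (if t then v else zeroA) x y ≡ t ∧ v x y
summand false v x y = refl
summand true  v x y = refl

lin-zero : ∀ m v i j → lin m (λ _ → false) v i j ≡ false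
lin-zero zero    v i j = refl
lin-zero (suc m) v i j = trans (xor-identityʳ _) (lin-zero m v i j)

lin-vanishes : ∀ m c v x y → (∀ k → k < m → v k x y ≡ false) → lin m c v x y ≡ false
lin-vanishes zero    c v x y _     = refl
lin-vanishes (suc m) c v x y v≡0 =
  cong₂ _xor_ (lin-vanishes m c v x y (λ k k<m → v≡0 k (m<n⇒m<1+n k<m)))
              (trans (summand (c m) (v m) x y) (trans (cong (c m ∧_) (v≡0 m ≤-refl)) (∧-zeroʳ (c m))))

lin-agree : ∀ m {c d} v → (∀ x → x < m → c x ≡ d x) → ∀ i j → lin m c v i j ≡ lin m d v i j
lin-agree zero    v _   i j = refl
lin-agree (suc m) v c≡d i j =
  cong₂ _xor_ (lin-agree m v (λ x x<m → c≡d x (m<n⇒m<1+n x<m)) i j)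
              (cong (λ t → (if t then v m else zeroA) i j) (c≡d m ≤-refl))

toggle : (ℕ → Bool) → ℕ → ℕ → Bool
toggle c k x = if does (x ≟ k) then not (c x) else c x

lin-toggle : ∀ m c k v → k < m → ∀ i j → lin m (toggle c k) v i j ≡ lin m c v i j xor v k i j
lin-toggle (suc m) c k v k<1+m i j with k ≟ m
... | yes refl = begin
  lin k (toggle c k) v i j xor (if toggle c k k then v k else zeroA) i j
    ≡⟨ cong₂ _xor_ (lin-agree k v below i j) (trans (summand (toggle c k k) (v k) i j) (cong (_∧ v k i j) flipped)) ⟩
  lin k c v i j xor (not (c k) ∧ v k i j)
    ≡⟨ xor-toggle (lin k c v i j) (c k) (v k i j) ⟩
  (lin k c v i j xor (c k ∧ v k i j)) xor v k i j
    ≡⟨ cong (λ w → (lin k c v i j xor w) xor v k i j) (sym (summand (c k) (v k) i j)) ⟩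
  lin (suc k) c v i j xor v k i j  ∎
  where
  open ≡-Reasoning
  below : ∀ x → x < k → toggle c k x ≡ c x
  below x x<k = cong (λ t → if t then not (c x) else c x) (dec-false (x ≟ k) (<⇒≢ x<k))
  flipped : toggle c k k ≡ not (c k)
  flipped = cong (λ t → if t then not (c k) else c k) (dec-true (k ≟ k) refl)
... | no k≢m = trans
  (cong₂ _xor_ (lin-toggle m c k v (≤∧≢⇒< (≤-pred k<1+m) k≢m) i j)
                (cong (λ t → (if t then v m else zeroA) i j)
                      (cong (λ t → if t then not (c m) else c m) (dec-false (m ≟ k) (≢-sym k≢m)))))
  (xor-swapʳ (lin m c v i j) (v k i j) _)

module Basis (n : ℕ) (T : ℕ → Arr)
  (T-rst : ∀ k → k < dim n → IsRST n (T k))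
  (T-top : ∀ k → k < dim n → H k (T k) ≈[ n ∸ 3 * k ] U (n ∸ 3 * k)) where

  -- Triangularity: H^M(T_j) = H^{M-j}(U_{n-3j}) = 0 for j < M.
  T-above : ∀ {j M} → j < M → j < dim n → H M (T j) ≈[ n ∸ 3 * M ] zeroA
  T-above {j} {M} j<M j<m =
    subst (λ M → H M (T j) ≈[ n ∸ 3 * M ] zeroA) (m∸n+n≡m (<⇒≤ j<M)) (above (M ∸ j) (m<n⇒0<n∸m j<M))
    where
    above : ∀ d → 1 ≤ d → H (d + j) (T j) ≈[ n ∸ 3 * (d + j) ] zeroA
    above d 1≤d i l 1≤i i≤l l≤ = begin
      H (d + j) (T j) i l       ≡⟨ H-compose d j (T j) i l ⟩
      H d (H j (T j)) i l       ≡⟨ H-respects d (T-top j j<m) i l 1≤i i≤l l≤′ ⟩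
      H d (U (n ∸ 3 * j)) i l   ≡⟨ H-U-vanishes (n ∸ 3 * j) d 1≤d i l 1≤i i≤l l≤′ ⟩
      false                     ∎
      where
      open ≡-Reasoning
      l≤′ : l ≤ (n ∸ 3 * j) ∸ 3 * d
      l≤′ = subst (l ≤_) (H-size n d j) l≤

  layer-coefficient : ∀ M c → M < dim n → ∀ i l → 1 ≤ i → i ≤ l → l ≤ n ∸ 3 * M →
                      H M (lin (suc M) c T) i l ≡ c M ∧ U (n ∸ 3 * M) i l
  layer-coefficient M c M<m i l 1≤i i≤l l≤ = begin
    H M (lin (suc M) c T) i l
      ≡⟨ cong₂ _xor_ (lin-vanishes M c T (M + i) (2 * M + l) lower) (summand (c M) (T M) (M + i) (2 * M + l)) ⟩
    c M ∧ H M (T M) i l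
      ≡⟨ cong (c M ∧_) (T-top M M<m i l 1≤i i≤l l≤) ⟩
    c M ∧ U (n ∸ 3 * M) i l  ∎
    where
    open ≡-Reasoning
    lower : ∀ j → j < M → T j (M + i) (2 * M + l) ≡ false
    lower j j<M = T-above j<M (<-trans j<M M<m) i l 1≤i i≤l l≤

  -- If c_0 T_0 + … + c_M T_M = 0 then c_M = 0: on layer M the sum is c_M · U_{n-3M} ≠ 0.
  top-coefficient : ∀ M c → M < dim n → lin (suc M) c T ≈[ n ] zeroA → c M ≡ false
  top-coefficient M c M<m lin≈0 with U-witness (below-dim⇒UNonzero n M M<m)
  ... | i , l , 1≤i , i≤l , l≤ , U≡true = begin
    c M                                ≡⟨ ∧-identityʳ (c M) ⟨
    c M ∧ true                         ≡⟨ cong (c M ∧_) U≡true ⟨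
    c M ∧ U (n ∸ 3 * M) i l            ≡⟨ layer-coefficient M c M<m i l 1≤i i≤l l≤ ⟨
    H M (lin (suc M) c T) i l          ≡⟨ H-respects M lin≈0 i l 1≤i i≤l l≤ ⟩
    false                              ∎
    where open ≡-Reasoning

  -- Linear independence, by reading off the coefficients from the top down.
  independent : ∀ M → M ≤ dim n → ∀ c → lin M c T ≈[ n ] zeroA → ∀ k → k < M → c k ≡ false
  independent (suc M) M<m c lin≈0 k k<1+M with m≤n⇒m<n∨m≡n (≤-pred k<1+M)
  ... | inj₂ refl = top-coefficient k c M<m lin≈0
  ... | inj₁ k<M = independent M (<⇒≤ M<m) c lower k k<M
    where
    lower : lin M c T ≈[ n ] zeroA
    lower i j 1≤i i≤j j≤n =
      trans (sym (xor-identityʳ (lin M c T i j)))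
            (trans (cong (λ t → lin M c T i j xor (if t then T M else zeroA) i j)
                         (sym (top-coefficient M c M<m lin≈0)))
                   (lin≈0 i j 1≤i i≤j j≤n))

  InSpan : Arr → Set
  InSpan a = Σ (ℕ → Bool) λ c → a ≈[ n ] lin (dim n) c T

  span-cancel : ∀ {a} k → k < dim n → InSpan (a ⊕ T k) → InSpan a
  span-cancel {a} k k<m (c , a+T≈) = toggle c k , λ i j 1≤i i≤j j≤n → begin
    a i j                               ≡⟨ xor-cancelʳ (a i j) (T k i j) ⟨
    (a ⊕ T k) i j xor T k i j           ≡⟨ cong (_xor T k i j) (a+T≈ i j 1≤i i≤j j≤n) ⟩
    lin (dim n) c T i j xor T k i j     ≡⟨ lin-toggle (dim n) c k T k<m i j ⟨
    lin (dim n) (toggle c k) T i j      ∎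
    where open ≡-Reasoning

  -- Spanning, by induction on the number k of layers on which a may be non-zero:
  -- the innermost such layer is 0 or U_{n-3k}, and in the latter case a + T_k has one layer less.
  spanned-below : ∀ k a → IsRST n a → H k a ≈[ n ∸ 3 * k ] zeroA → InSpan a
  spanned-below zero a _ a≈0 =
    (λ _ → false) , λ i j 1≤i i≤j j≤n → trans (a≈0 i j 1≤i i≤j j≤n) (sym (lin-zero (dim n) T i j))
  spanned-below (suc k) a a-rst top≈0
    with peel-layer (n ∸ 3 * k) (H k a) (Hk-RST k a a-rst) (H-top-layer n k a top≈0)
  ... | inj₁ Hk≈0         = spanned-below k a a-rst Hk≈0
  ... | inj₂ (Hk≈U , U≢0) =
    span-cancel k k<m (spanned-below k (a ⊕ T k) (RST-⊕ a-rst (T-rst k k<m)) cancelled)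
    where
    k<m : k < dim n
    k<m = UNonzero⇒below-dim n k U≢0
    cancelled : H k (a ⊕ T k) ≈[ n ∸ 3 * k ] zeroA
    cancelled i j 1≤i i≤j j≤ =
      trans (cong₂ _xor_ (Hk≈U i j 1≤i i≤j j≤) (T-top k k<m i j 1≤i i≤j j≤)) (xor-same (U (n ∸ 3 * k) i j))

  -- every a ∈ RST(n) lives on at most n layers, since H^n(a) is the empty triangle
  spanning : ∀ a → IsRST n a → InSpan a
  spanning a a-rst = spanned-below n a a-rst (subst (λ N → H n a ≈[ N ] zeroA) (sym n∸3n≡0) ≈-empty)
    where
    n∸3n≡0 : n ∸ 3 * n ≡ 0
    n∸3n≡0 = m≤n⇒m∸n≡0 (m≤m+n n (2 * n))

  basis : IsBasisRST n (dim n) T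
  basis = T-rst , independent (dim n) ≤-refl , spanning

mainTheorem7 : (n : ℕ) → (T : ℕ → Arr) →
    (∀ k → k < n / 3 + δ1mod3 n → IsRST n (T k)) →
    (∀ k → k < n / 3 + δ1mod3 n →
      H k (T k) ≈[ n ∸ 3 * k ] U (n ∸ 3 * k)) →
    IsBasisRST n (n / 3 + δ1mod3 n) T
mainTheorem7 n T T-rst T-top = Basis.basis n T T-rst T-top
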